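{- Let $v$ be an $(a-c,b-d)$-bispecial factor of $\mathbf u_\beta$. Then there exist $n\in\mathbb N$ and letters $a',b',c',d'\in\mathcal A$ such that $v$ is the $f^n$-image of the $(a'-c',b'-d')$-bispecial factor $0^k$ for some $0\le k\le t_1-1$.
   Context: Let $\beta>1$ be a non-simple Parry number: its Rényi expansion of unity $d_\beta(1)=t_1t_2t_3\cdots$ (nonnegative integers with $t_1=\lfloor\beta\rfloor$, $1=\sum_{i\ge1}t_i\beta^{ -i}$, and $t_it_{i+1}\cdots\prec t_1t_2\cdots$ lexicographically for all $i\ge2$) has the form $t_1\cdots t_m(t_{m+1}\cdots t_{m+p})^\omega$ and is not of the form $t_1\cdots t_k0^\omega$, with $m,p\ge1$ least possible (so $t_m\neq t_{m+p}$). Assume $t_1\ge2$. On $\mathcal A=\{0,1,\dots,m+p-1\}$ let $\varphi$ be the substitution $\varphi(k)=0^{t_{k+1}}(k+1)$ for $0\le k\le m+p-2$, $\varphi(m+p-1)=0^{t_{m+p}}m$, and $\mathbf u_\beta=\lim_n\varphi^n(0)$ its fixed point. For $k,\ell\in\mathbb N$, $k\oplus\ell$ is the letter $k+\ell$ if $k+\ell<m+p$ and $m+((k+\ell-m)\bmod p)$ otherwise; for $k+\ell>0$, $t_{k\oplus\ell}$ denotes $t_{k+\ell}$ if $k+\ell\le m+p$ and $t_{m+1+((k+\ell-m-1)\bmod p)}$ otherwise. Let $t=\min\{t_m,t_{m+p}\}$ and let $z$ be the unique nonzero letter such that $z0^tm$ is a factor of $\mathbf u_\beta$. For letters $a\ne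 b$, $c\ne d$, a factor $v$ is an $(a-c,b-d)$-bispecial factor if $avc$ and $bvd$ are both factors of $\mathbf u_\beta$. For distinct letters $x,y$, $f_L(x,y)$ (resp. $f_R(x,y)$) is the longest common suffix (resp. prefix) of $\varphi(x)$ and $\varphi(y)$. The $f$-image of an $(a-c,b-d)$-bispecial factor $v$ is $f(v)=f_L(a,b)\varphi(v)f_R(c,d)$; it is an $(a'-c',b'-d')$-bispecial factor where, with $\mu=\min\{t_{c\oplus1},t_{d\oplus1}\}$, $c',d'$ are the first letters of $0^{t_{c\oplus1}-\mu}(c\oplus1)$ and $0^{t_{d\oplus1}-\mu}(d\oplus1)$, and $a',b'$ are $0$ and $z$ (in some order) if $\{a,b\}=\{m-1,m+p-1\}$ and $a\oplus1,b\oplus1$ otherwise. The $f^n$-image is obtained by applying $f$ $n$ times, updating the extension letters by this rule at each step (the $f^0$-image is the factor itself). -}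

module Defs where

open import Data.Nat using (ℕ; zero; suc; _+_; _∸_; _≤_; _<_; _⊓_; NonZero; _≟_; _<?_; _≤?_)
open import Data.Nat.DivMod using (_%_)
open import Data.List using (List; []; _∷_; _++_; replicate; map; upTo; length; reverse; concatMap)
open import Data.Bool using (Bool; true; false; if_then_else_; _∧_; _∨_)
open import Data.Product using (_×_; _,_; ∃-syntax)
open import Relation.Nullary using (¬_)
open import Relation.Nullary.Decidable using (⌊_⌋)
open import Relation.Binary.PropositionalEquality using (_≡_; _≢_)

iter : {A : Set} → (A → A) → ℕ → A → A
iter f zero    x = x
iter f (suc n) x = f (iter f n x)

-- i-th element of a list (default 0; never used for u below)
nth : List ℕ → ℕ → ℕ
nth []       _       = 0
nth (x ∷ _)  zero    = x
nth (_ ∷ xs) (suc i) = nth xs i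

commonPrefix : List ℕ → List ℕ → List ℕ
commonPrefix (x ∷ xs) (y ∷ ys) = if ⌊ x ≟ y ⌋ then x ∷ commonPrefix xs ys else []
commonPrefix _ _ = []

commonSuffix : List ℕ → List ℕ → List ℕ
commonSuffix xs ys = reverse (commonPrefix (reverse xs) (reverse ys))

LexLess : (ℕ → ℕ) → (ℕ → ℕ) → Set
LexLess s r = ∃[ k ] ((∀ j → j < k → s j ≡ r j) × s k < r k)

-- The data d_β(1) = t_1 … t_m (t_{m+1} … t_{m+p})^ω is given by m, p and the
-- values t 1, …, t (m+p) (other values of t are irrelevant).
module _ (m p : ℕ) {{_ : NonZero p}} (t : ℕ → ℕ) where

  -- the infinite sequence t_1 t_2 t_3 … ;  tt i = t_i for i ≥ 1
  -- (this is also t_{k ⊕ ℓ} with i = k + ℓ)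
  tt : ℕ → ℕ
  tt i = if ⌊ i ≤? m + p ⌋ then t i else t (suc m + ((i ∸ m ∸ 1) % p))

  _⊕_ : ℕ → ℕ → ℕ
  k ⊕ ℓ = if ⌊ k + ℓ <? m + p ⌋ then k + ℓ else m + ((k + ℓ ∸ m) % p)

  -- d_β(1) as above is the Rényi expansion of unity of a non-simple Parry
  -- number β > 1 (Parry's characterisation), with m, p ≥ 1 least possible
  IsNonSimpleParryData : Set
  IsNonSimpleParryData =
      (1 ≤ m)
    × (∀ i → 2 ≤ i → LexLess (λ j → tt (i + j)) (λ j → tt (1 + j)))
    × (¬ (∃[ k ] (∀ j → k < j → tt j ≡ 0)))
    × (∀ m' p' → 1 ≤ m' → 1 ≤ p' → (∀ j → m' < j → tt (j + p') ≡ tt j)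
         → (m ≤ m') × (p ≤ p'))

  φ : ℕ → List ℕ
  φ k = replicate (tt (suc k)) 0 ++ (k ⊕ 1) ∷ []

  φ* : List ℕ → List ℕ
  φ* = concatMap φ

  -- u_β = lim φ^n(0); its i-th letter (indexing from 0) read off φ^{i+1}(0),
  -- which has length > i
  u : ℕ → ℕ
  u i = nth (iter φ* (suc i) (0 ∷ [])) i

  Factor : List ℕ → Set
  Factor w = ∃[ i ] (w ≡ map (λ j → u (i + j)) (upTo (length w)))

  Bispecial : ℕ → ℕ → ℕ → ℕ → List ℕ → Set
  Bispecial a b c d v =
    (a ≢ b) × (c ≢ d) × Factor (a ∷ v ++ c ∷ []) × Factor (b ∷ v ++ d ∷ [])

  tmin : ℕ
  tmin = t m ⊓ t (m + p)

  IsZ : ℕ → Set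
  IsZ z = (z ≢ 0) × Factor (z ∷ replicate tmin 0 ++ m ∷ [])
        × (∀ y → y ≢ 0 → Factor (y ∷ replicate tmin 0 ++ m ∷ []) → y ≡ z)

  fL fR : ℕ → ℕ → List ℕ
  fL x y = commonSuffix (φ x) (φ y)
  fR x y = commonPrefix (φ x) (φ y)

  -- a bispecial factor together with its extension letters (a, b, c, d, v)
  Ext : Set
  Ext = ℕ × ℕ × ℕ × ℕ × List ℕ

  fstep : ℕ → Ext → Ext
  fstep z (a , b , c , d , v) = (a' , b' , c' , d' , fL a b ++ φ* v ++ fR c d)
    where
    special : Bool
    special = (⌊ a ≟ m ∸ 1 ⌋ ∧ ⌊ b ≟ m + p ∸ 1 ⌋) ∨ (⌊ a ≟ m + p ∸ 1 ⌋ ∧ ⌊ b ≟ m ∸ 1 ⌋)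
    aFirst : Bool
    aFirst = ⌊ tt (suc b) <? tt (suc a) ⌋
    a' b' : ℕ
    a' = if special then (if aFirst then 0 else z) else a ⊕ 1
    b' = if special then (if aFirst then z else 0) else b ⊕ 1
    μ : ℕ
    μ = tt (suc c) ⊓ tt (suc d)
    c' d' : ℕ
    c' = if ⌊ μ <? tt (suc c) ⌋ then 0 else c ⊕ 1
    d' = if ⌊ μ <? tt (suc d) ⌋ then 0 else d ⊕ 1

-- u_β = φ(u_β), and φ is injective on words: the images 0^{t_{k+1}} (k ⊕ 1) of two distinct
-- letters end with different letters, except for the pair {m - 1, m + p - 1}, whose images have
-- different numbers of zeros because t_m ≠ t_{m+p} by minimality of (m , p).
--
-- Cut u_β into the blocks φ(u_N). In an occurrence of a v c, either v = 0^k lies inside the zeros of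
-- one block (so k < t₁), or v = X φ(w) 0^r, where X is empty (a ends a block) or the tail
-- 0^s (u_N ⊕ 1) of a block (a = 0), 0^r is a proper prefix of the next block and c is read off it.
-- For the two occurrences a v c and b v d the decompositions agree after X, so a₀ w c₀ and b₀ w d₀
-- form a bispecial factor w with f-image v; if a = 0 ≠ b, the letters before w are the colliding
-- pair and b = z. These occurrences lie strictly to the left of the original ones (here t₁ ≥ 2 is
-- used), so induction on their positions ends at a factor 0^k with k < t₁.

module Submission where

open import Defs
open import Data.Nat
  using (ℕ; zero; suc; _+_; _∸_; _≤_; _<_; _⊓_; NonZero; >-nonZero⁻¹; z≤n; s≤s; _≟_; _<?_; _≤?_)
open import Data.Nat.Properties
open import Data.Nat.Induction using (<-rec)
open import Data.Nat.DivMod using (_%_; m%n<n; [m+n]%n≡m%n; m<n⇒m%n≡m; n%n≡0)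
open import Data.List using (List; []; _∷_; _++_; [_]; replicate; reverse; length; map; upTo; applyUpTo)
open import Data.List.Relation.Unary.All using (All; []; _∷_)
open import Data.List.Relation.Unary.All.Properties using (++⁺; replicate⁺)
open import Data.List.Properties
  using ( ∷-injective; ≡-dec; ++-assoc; ++-identityʳ; ++-conicalˡ; ++-conicalʳ; length-++; length-replicate
        ; concatMap-++; map-applyUpTo; reverse-++; unfold-reverse; reverse-injective )
open import Data.Bool using (Bool; true; false; if_then_else_; _∧_; _∨_)
open import Data.Product using (_×_; _,_; proj₁; proj₂; map₂; swap; ∃-syntax)
open import Data.Sum using (_⊎_; inj₁; inj₂)
open import Data.Unit using (⊤)
open import Relation.Nullary using (¬_; Dec; yes; no; does; contradiction)
open import Relation.Nullary.Decidable using (⌊_⌋; isYes≗does; dec-true; dec-false; _×-dec_; _⊎-dec_)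
open import Relation.Binary.PropositionalEquality
  using (_≡_; _≢_; refl; sym; trans; cong; cong₂; subst; subst₂; module ≡-Reasoning)
open import Function using (_∘′_; case_of_)

isYes-true : ∀ {P : Set} (d : Dec P) → P → ⌊ d ⌋ ≡ true
isYes-true d x = trans (isYes≗does d) (dec-true d x)

if-<-flip : ∀ {A : Set} {x y : ℕ} (u w : A) → x ≢ y →
  (if ⌊ x <? y ⌋ then u else w) ≡ (if ⌊ y <? x ⌋ then w else u)
if-<-flip {x = x} {y} u w x≢y with x <? y | y <? x
... | yes x<y | yes y<x = contradiction y<x (<-asym x<y)
... | yes _   | no  _   = refl
... | no  _   | yes _   = refl
... | no  x≮y | no  y≮x = contradiction (≤-antisym (≮⇒≥ y≮x) (≮⇒≥ x≮y)) x≢y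

nth-++ˡ : ∀ (xs ys : List ℕ) {j} → j < length xs → nth (xs ++ ys) j ≡ nth xs j
nth-++ˡ (x ∷ xs) ys {zero}  _         = refl
nth-++ˡ (x ∷ xs) ys {suc j} (s≤s j<) = nth-++ˡ xs ys j<

nth-++ʳ : ∀ (xs ys : List ℕ) j → nth (xs ++ ys) (length xs + j) ≡ nth ys j
nth-++ʳ []       ys j = refl
nth-++ʳ (x ∷ xs) ys j = nth-++ʳ xs ys j

nth-replicate-++ : ∀ s (ys : List ℕ) {j} → j < s → nth (replicate s 0 ++ ys) j ≡ 0
nth-replicate-++ (suc s) ys {zero}  _        = refl
nth-replicate-++ (suc s) ys {suc j} (s≤s j<) = nth-replicate-++ s ys j<

replicate-+ : ∀ {A : Set} r s (x : A) → replicate (r + s) x ≡ replicate r x ++ replicate s x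
replicate-+ zero    s x = refl
replicate-+ (suc r) s x = cong (x ∷_) (replicate-+ r s x)

reverse-replicate : ∀ {A : Set} r (x : A) → reverse (replicate r x) ≡ replicate r x
reverse-replicate zero    x = refl
reverse-replicate (suc r) x = begin
  reverse (x ∷ replicate r x)     ≡⟨ unfold-reverse x (replicate r x) ⟩
  reverse (replicate r x) ++ [ x ] ≡⟨ cong (_++ [ x ]) (reverse-replicate r x) ⟩
  replicate r x ++ [ x ]           ≡⟨ replicate-+ r 1 x ⟨
  replicate (r + 1) x              ≡⟨ cong (λ n → replicate n x) (+-comm r 1) ⟩
  replicate (suc r) x              ∎
  where open ≡-Reasoning

++-cancel-≡-length : ∀ {A : Set} (xs ys : List A) {zs ws} → length xs ≡ length ys →
  xs ++ zs ≡ ys ++ ws → xs ≡ ys × zs ≡ ws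
++-cancel-≡-length []       []       _ e = refl , e
++-cancel-≡-length (x ∷ xs) (y ∷ ys) l e with refl , e′ ← ∷-injective e
  with refl , e″ ← ++-cancel-≡-length xs ys (suc-injective l) e′ = refl , e″

zerosThen : ℕ → ℕ → List ℕ
zerosThen s x = replicate s 0 ++ [ x ]

nth-zerosThen-last : ∀ s x → nth (zerosThen s x) s ≡ x
nth-zerosThen-last zero    x = refl
nth-zerosThen-last (suc s) x = nth-zerosThen-last s x

nth-zerosThen : ∀ s x {r} → r ≤ s → nth (zerosThen s x) r ≡ (if ⌊ r <? s ⌋ then 0 else x)
nth-zerosThen s x {r} r≤s with r <? s
... | yes r<s = nth-replicate-++ s [ x ] r<s
... | no  r≮s with refl ← ≤-antisym r≤s (≮⇒≥ r≮s) = nth-zerosThen-last s x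

HeadNonzero : List ℕ → Set
HeadNonzero []      = ⊤
HeadNonzero (x ∷ _) = x ≢ 0

LastNonzero : List ℕ → Set
LastNonzero xs = HeadNonzero (reverse xs)

replicate-0-cancelˡ : ∀ r r′ {xs ys} → HeadNonzero xs → HeadNonzero ys →
  replicate r 0 ++ xs ≡ replicate r′ 0 ++ ys → r ≡ r′ × xs ≡ ys
replicate-0-cancelˡ zero    zero     _  _  e = refl , e
replicate-0-cancelˡ zero    (suc r′) {x ∷ _} x≢0 _ e = contradiction (proj₁ (∷-injective e)) x≢0
replicate-0-cancelˡ (suc r) zero     {ys = y ∷ _} _ y≢0 e = contradiction (sym (proj₁ (∷-injective e))) y≢0
replicate-0-cancelˡ (suc r) (suc r′) hx hy e
  with refl , e′ ← replicate-0-cancelˡ r r′ hx hy (proj₂ (∷-injective e)) = refl , e′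

replicate-0-cancelʳ : ∀ r r′ {xs ys} → LastNonzero xs → LastNonzero ys →
  xs ++ replicate r 0 ≡ ys ++ replicate r′ 0 → r ≡ r′ × xs ≡ ys
replicate-0-cancelʳ r r′ {xs} {ys} hx hy e =
  map₂ reverse-injective (replicate-0-cancelˡ r r′ hx hy reversed)
  where
  open ≡-Reasoning
  reversed : replicate r 0 ++ reverse xs ≡ replicate r′ 0 ++ reverse ys
  reversed = begin
    replicate r 0 ++ reverse xs           ≡⟨ cong (_++ reverse xs) (reverse-replicate r 0) ⟨
    reverse (replicate r 0) ++ reverse xs ≡⟨ reverse-++ xs (replicate r 0) ⟨
    reverse (xs ++ replicate r 0)         ≡⟨ cong reverse e ⟩
    reverse (ys ++ replicate r′ 0)        ≡⟨ reverse-++ ys (replicate r′ 0) ⟩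
    reverse (replicate r′ 0) ++ reverse ys ≡⟨ cong (_++ reverse ys) (reverse-replicate r′ 0) ⟩
    replicate r′ 0 ++ reverse ys          ∎

LastNonzero-++ : ∀ xs ys → LastNonzero xs → LastNonzero ys → LastNonzero (xs ++ ys)
LastNonzero-++ xs ys hx hy rewrite reverse-++ xs ys with reverse ys
... | []    = hx
... | _ ∷ _ = hy

LastNonzero-zerosThen : ∀ s {x} → x ≢ 0 → LastNonzero (zerosThen s x)
LastNonzero-zerosThen s {x} x≢0 rewrite reverse-++ (replicate s 0) [ x ] = x≢0

commonPrefix-comm : ∀ xs ys → commonPrefix xs ys ≡ commonPrefix ys xs
commonPrefix-comm []       []       = refl
commonPrefix-comm []       (_ ∷ _)  = refl
commonPrefix-comm (_ ∷ _)  []       = refl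
commonPrefix-comm (x ∷ xs) (y ∷ ys) with x ≟ y | y ≟ x
... | yes refl | yes _   = cong (x ∷_) (commonPrefix-comm xs ys)
... | yes refl | no y≢x  = contradiction refl y≢x
... | no x≢y   | yes refl = contradiction refl x≢y
... | no _     | no _    = refl

commonSuffix-comm : ∀ xs ys → commonSuffix xs ys ≡ commonSuffix ys xs
commonSuffix-comm xs ys = cong reverse (commonPrefix-comm (reverse xs) (reverse ys))

commonPrefix-zerosThen : ∀ {p q x y} r → x ≢ 0 → y ≢ 0 → r ≤ p → r ≤ q →
  nth (zerosThen p x) r ≢ nth (zerosThen q y) r →
  commonPrefix (zerosThen p x) (zerosThen q y) ≡ replicate r 0
commonPrefix-zerosThen {zero}  {zero}  {x} {y} zero _ _ _ _ x≢y with x ≟ y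
... | yes x≡y = contradiction x≡y x≢y
... | no  _   = refl
commonPrefix-zerosThen {zero}  {suc q} {x} zero x≢0 _ _ _ _ with x ≟ 0
... | yes x≡0 = contradiction x≡0 x≢0
... | no  _   = refl
commonPrefix-zerosThen {suc p} {zero}  {y = y} zero _ y≢0 _ _ _ with 0 ≟ y
... | yes 0≡y = contradiction (sym 0≡y) y≢0
... | no  _   = refl
commonPrefix-zerosThen {suc p} {suc q} zero _ _ _ _ 0≢0 = contradiction refl 0≢0
commonPrefix-zerosThen {suc p} {suc q} (suc r) x≢0 y≢0 (s≤s r≤p) (s≤s r≤q) differ =
  cong (0 ∷_) (commonPrefix-zerosThen r x≢0 y≢0 r≤p r≤q differ)

zerosThen-firstDifference : ∀ {p q x y r} → r ≤ p → r ≤ q →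
  nth (zerosThen p x) r ≢ nth (zerosThen q y) r → p ⊓ q ≡ r
zerosThen-firstDifference {p} {q} {x} {y} r≤p r≤q differ
  with m≤n⇒m<n∨m≡n r≤p | m≤n⇒m<n∨m≡n r≤q
... | inj₁ r<p | inj₁ r<q =
  contradiction (trans (nth-replicate-++ p [ x ] r<p) (sym (nth-replicate-++ q [ y ] r<q))) differ
... | inj₂ refl | _        = m≤n⇒m⊓n≡m r≤q
... | inj₁ r<p | inj₂ refl = m≥n⇒m⊓n≡n r≤p

reverse-zerosThen : ∀ s x → reverse (zerosThen s x) ≡ x ∷ replicate s 0
reverse-zerosThen s x = trans (reverse-++ (replicate s 0) [ x ]) (cong (x ∷_) (reverse-replicate s 0))

commonSuffix-zerosThen-≢ : ∀ p q {x y} → x ≢ y → commonSuffix (zerosThen p x) (zerosThen q y) ≡ []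
commonSuffix-zerosThen-≢ p q {x} {y} x≢y
  rewrite reverse-zerosThen p x | reverse-zerosThen q y with x ≟ y
... | yes x≡y = contradiction x≡y x≢y
... | no  _   = refl

commonSuffix-zerosThen-≡ : ∀ p q x → commonSuffix (zerosThen p x) (zerosThen q x) ≡ zerosThen (p ⊓ q) x
commonSuffix-zerosThen-≡ p q x
  rewrite reverse-zerosThen p x | reverse-zerosThen q x with x ≟ x
... | no x≢x = contradiction refl x≢x
... | yes _  = begin
  reverse (x ∷ commonPrefix (replicate p 0) (replicate q 0))
    ≡⟨ cong (λ zs → reverse (x ∷ zs)) (commonPrefix-replicate p q) ⟩
  reverse (x ∷ replicate (p ⊓ q) 0)      ≡⟨ unfold-reverse x (replicate (p ⊓ q) 0) ⟩
  reverse (replicate (p ⊓ q) 0) ++ [ x ] ≡⟨ cong (_++ [ x ]) (reverse-replicate (p ⊓ q) 0) ⟩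
  zerosThen (p ⊓ q) x                    ∎
  where
  open ≡-Reasoning
  commonPrefix-replicate : ∀ p q → commonPrefix (replicate p 0) (replicate q 0) ≡ replicate (p ⊓ q) 0
  commonPrefix-replicate zero    q       = refl
  commonPrefix-replicate (suc p) zero    = refl
  commonPrefix-replicate (suc p) (suc q) = cong (0 ∷_) (commonPrefix-replicate p q)

Prefix : List ℕ → List ℕ → Set
Prefix xs ys = ∃[ zs ] ys ≡ xs ++ zs

Prefix-trans : ∀ {xs ys zs} → Prefix xs ys → Prefix ys zs → Prefix xs zs
Prefix-trans {xs} (ws , refl) (ws′ , refl) = ws ++ ws′ , ++-assoc xs ws ws′

Prefix-nth : ∀ {xs ys} j → Prefix xs ys → j < length xs → nth ys j ≡ nth xs j
Prefix-nth {xs} j (zs , refl) j< = nth-++ˡ xs zs j<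

All-nth : ∀ {P : ℕ → Set} {xs} j → All P xs → j < length xs → P (nth xs j)
All-nth zero    (px ∷ _)   _        = px
All-nth (suc j) (_ ∷ pxs) (s≤s j<) = All-nth j pxs j<

suc-∸1 : ∀ {n} → 1 ≤ n → suc (n ∸ 1) ≡ n
suc-∸1 (s≤s _) = refl

module ParryData (m p : ℕ) {{_ : NonZero p}} (t : ℕ → ℕ)
                 (parry : IsNonSimpleParryData m p t) (t₁≥2 : 2 ≤ t 1) where

  T : ℕ → ℕ
  T = tt m p t

  _⊕1 : ℕ → ℕ
  k ⊕1 = _⊕_ m p t k 1

  m≥1 : 1 ≤ m
  m≥1 = proj₁ parry

  m+p≥1 : 1 ≤ m + p
  m+p≥1 = ≤-trans m≥1 (m≤m+n m p)

  T-low : ∀ {i} → i ≤ m + p → T i ≡ t i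
  T-low {i} i≤ with i ≤? m + p
  ... | yes _ = refl
  ... | no  i≰ = contradiction i≤ i≰

  T-high : ∀ {i} → m + p < i → T i ≡ t (suc m + ((i ∸ m ∸ 1) % p))
  T-high {i} i> with i ≤? m + p
  ... | yes i≤ = contradiction i≤ (<⇒≱ i>)
  ... | no  _  = refl

  T-periodic : ∀ j → m < j → T (j + p) ≡ T j
  T-periodic j m<j = subst (λ i → T (i + p) ≡ T i) (m+[n∸m]≡n m<j) (shifted (j ∸ suc m))
    where
    open ≡-Reasoning
    shift : ∀ x → suc m + x ∸ m ∸ 1 ≡ x
    shift x = cong (_∸ 1) (trans (cong (_∸ m) (sym (+-suc m x))) (m+n∸m≡n m (suc x)))
    reduce : ∀ e → t (suc m + e % p) ≡ T (suc m + e)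
    reduce e with e <? p
    ... | yes e<p = trans (cong (λ x → t (suc m + x)) (m<n⇒m%n≡m e<p))
                          (sym (T-low (subst (_≤ m + p) (+-suc m e) (+-monoʳ-≤ m e<p))))
    ... | no  e≮p =
      sym (trans (T-high (s≤s (+-monoʳ-≤ m (≮⇒≥ e≮p)))) (cong (λ x → t (suc m + x % p)) (shift e)))
    shifted : ∀ e → T (suc m + e + p) ≡ T (suc m + e)
    shifted e = begin
      T (suc m + e + p)                         ≡⟨ T-high (+-monoˡ-< p (s≤s (m≤m+n m e))) ⟩
      t (suc m + ((suc m + e + p ∸ m ∸ 1) % p))
        ≡⟨ cong (λ y → t (suc m + ((y ∸ m ∸ 1) % p))) (+-assoc (suc m) e p) ⟩
      t (suc m + ((suc m + (e + p) ∸ m ∸ 1) % p)) ≡⟨ cong (λ x → t (suc m + (x % p))) (shift (e + p)) ⟩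
      t (suc m + ((e + p) % p))                 ≡⟨ cong (λ x → t (suc m + x)) ([m+n]%n≡m%n e p) ⟩
      t (suc m + e % p)                         ≡⟨ reduce e ⟩
      T (suc m + e)                             ∎

  T-periodic-from-m∸1 : T m ≡ T (m + p) → ∀ j → m ∸ 1 < j → T (j + p) ≡ T j
  T-periodic-from-m∸1 Tm≡ j m∸1<j with m <? j
  ... | yes m<j = T-periodic j m<j
  ... | no  m≮j with refl ← ≤-antisym (subst (_≤ j) (suc-∸1 m≥1) m∸1<j) (≮⇒≥ m≮j) = sym Tm≡

  -- Minimality of (m , p) rules out the preperiod m - 1; for m = 1 it would make d_β(1)
  -- purely periodic, against the lexicographic condition at i = 1 + p.
  T-m≢T-m+p : T m ≢ T (m + p)
  T-m≢T-m+p Tm≡ with m ≟ 1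
  ... | yes refl with K , _ , T<T ← proj₁ (proj₂ parry) (1 + p) (s≤s (>-nonZero⁻¹ p)) =
    <-irrefl (trans (cong T (cong suc (+-comm p K))) (T-periodic-from-m∸1 Tm≡ (1 + K) (s≤s z≤n))) T<T
  ... | no m≢1 = <-irrefl refl (subst (_≤ m ∸ 1) (sym (suc-∸1 m≥1)) m≤m∸1)
    where
    m≤m∸1 : m ≤ m ∸ 1
    m≤m∸1 = proj₁ (proj₂ (proj₂ (proj₂ parry)) (m ∸ 1) p
                    (∸-monoˡ-≤ 1 (≤∧≢⇒< m≥1 (m≢1 ∘′ sym))) (>-nonZero⁻¹ p) (T-periodic-from-m∸1 Tm≡))

  T-suc≤t₁ : ∀ k → T (suc k) ≤ t 1
  T-suc≤t₁ zero = ≤-reflexive (T-low m+p≥1)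
  T-suc≤t₁ (suc k) with proj₁ (proj₂ parry) (suc (suc k)) (s≤s (s≤s z≤n))
  ... | zero  , _ , T<T₁ = ≤-trans (≤-reflexive (cong T (sym (+-identityʳ _)))) (≤-trans (<⇒≤ T<T₁) (T-suc≤t₁ zero))
  ... | suc _ , T≡T₁ , _ =
    ≤-trans (≤-reflexive (trans (cong T (sym (+-identityʳ _))) (T≡T₁ 0 (s≤s z≤n)))) (T-suc≤t₁ zero)

  ⊕1≢0 : ∀ k → k ⊕1 ≢ 0
  ⊕1≢0 k with k + 1 <? m + p
  ... | yes _ = λ k+1≡0 → 1+n≢0 (trans (+-comm 1 k) k+1≡0)
  ... | no  _ = λ m+r≡0 → <⇒≢ m≥1 (sym (m+n≡0⇒m≡0 m m+r≡0))

  ⊕1<m+p : ∀ k → k ⊕1 < m + p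
  ⊕1<m+p k with k + 1 <? m + p
  ... | yes k+1< = k+1<
  ... | no  _    = +-monoʳ-< m (m%n<n _ p)

  ⊕1-letter : ∀ {k} → k < m + p → (suc k < m + p × k ⊕1 ≡ suc k) ⊎ (k ≡ m + p ∸ 1 × k ⊕1 ≡ m)
  ⊕1-letter {k} k< with k + 1 <? m + p
  ... | yes k+1< = inj₁ (subst (_< m + p) (+-comm k 1) k+1< , +-comm k 1)
  ... | no  k+1≮ = inj₂ (trans (sym (m+n∸n≡m k 1)) (cong (_∸ 1) k+1≡m+p) , wraps)
    where
    open ≡-Reasoning
    k+1≡m+p : k + 1 ≡ m + p
    k+1≡m+p = ≤-antisym (subst (_≤ m + p) (+-comm 1 k) k<) (≮⇒≥ k+1≮)
    wraps : m + ((k + 1 ∸ m) % p) ≡ m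
    wraps = begin
      m + ((k + 1 ∸ m) % p) ≡⟨ cong (λ x → m + ((x ∸ m) % p)) k+1≡m+p ⟩
      m + ((m + p ∸ m) % p) ≡⟨ cong (λ x → m + x % p) (m+n∸m≡n m p) ⟩
      m + p % p             ≡⟨ cong (m +_) (n%n≡0 p) ⟩
      m + 0                 ≡⟨ +-identityʳ m ⟩
      m                     ∎

  -- {m - 1, m + p - 1}: the only two distinct letters with the same k ⊕ 1
  CollidingPair : ℕ → ℕ → Set
  CollidingPair k w = (k ≡ m ∸ 1 × w ≡ m + p ∸ 1) ⊎ (k ≡ m + p ∸ 1 × w ≡ m ∸ 1)

  CollidingPair? : ∀ k w → Dec (CollidingPair k w)
  CollidingPair? k w = (k ≟ m ∸ 1 ×-dec w ≟ m + p ∸ 1) ⊎-dec (k ≟ m + p ∸ 1 ×-dec w ≟ m ∸ 1)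

  CollidingPair-sym : ∀ {k w} → CollidingPair k w → CollidingPair w k
  CollidingPair-sym (inj₁ (k≡ , w≡)) = inj₂ (w≡ , k≡)
  CollidingPair-sym (inj₂ (k≡ , w≡)) = inj₁ (w≡ , k≡)

  ⊕1-collision : ∀ {k w} → k < m + p → w < m + p → k ≢ w → k ⊕1 ≡ w ⊕1 →
    CollidingPair k w × k ⊕1 ≡ m
  ⊕1-collision {k} {w} k< w< k≢w ⊕1≡ with ⊕1-letter k< | ⊕1-letter w<
  ... | inj₁ (_ , k⊕1≡) | inj₁ (_ , w⊕1≡) =
    contradiction (suc-injective (trans (sym k⊕1≡) (trans ⊕1≡ w⊕1≡))) k≢w
  ... | inj₁ (_ , k⊕1≡) | inj₂ (w≡ , w⊕1≡) =
    inj₁ (cong (_∸ 1) (trans (sym k⊕1≡) (trans ⊕1≡ w⊕1≡)) , w≡) , trans ⊕1≡ w⊕1≡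
  ... | inj₂ (k≡ , k⊕1≡) | inj₁ (_ , w⊕1≡) =
    inj₂ (k≡ , cong (_∸ 1) (trans (sym w⊕1≡) (trans (sym ⊕1≡) k⊕1≡))) , k⊕1≡
  ... | inj₂ (k≡ , _) | inj₂ (w≡ , _) = contradiction (trans k≡ (sym w≡)) k≢w

  m∸1<m+p : m ∸ 1 < m + p
  m∸1<m+p = subst (_≤ m + p) (sym (suc-∸1 m≥1)) (m≤m+n m p)

  m+p∸1<m+p : m + p ∸ 1 < m + p
  m+p∸1<m+p = subst (_≤ m + p) (sym (suc-∸1 m+p≥1)) ≤-refl

  m∸1⊕1≡m : (m ∸ 1) ⊕1 ≡ m
  m∸1⊕1≡m with ⊕1-letter m∸1<m+p
  ... | inj₁ (_ , ⊕1≡) = trans ⊕1≡ (suc-∸1 m≥1)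
  ... | inj₂ (_ , ⊕1≡) = ⊕1≡

  m+p∸1⊕1≡m : (m + p ∸ 1) ⊕1 ≡ m
  m+p∸1⊕1≡m with ⊕1-letter m+p∸1<m+p
  ... | inj₁ (top+1< , _) = contradiction (subst (_< m + p) (suc-∸1 m+p≥1) top+1<) (<-irrefl refl)
  ... | inj₂ (_ , ⊕1≡)    = ⊕1≡

  CollidingPair⇒⊕1≡ : ∀ {k w} → CollidingPair k w → k ⊕1 ≡ w ⊕1
  CollidingPair⇒⊕1≡ (inj₁ (refl , refl)) = trans m∸1⊕1≡m (sym m+p∸1⊕1≡m)
  CollidingPair⇒⊕1≡ (inj₂ (refl , refl)) = trans m+p∸1⊕1≡m (sym m∸1⊕1≡m)

  T-suc-m∸1 : T (suc (m ∸ 1)) ≡ t m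
  T-suc-m∸1 = trans (cong T (suc-∸1 m≥1)) (T-low (m≤m+n m p))

  T-suc-m+p∸1 : T (suc (m + p ∸ 1)) ≡ t (m + p)
  T-suc-m+p∸1 = trans (cong T (suc-∸1 m+p≥1)) (T-low ≤-refl)

  CollidingPair⇒T≢ : ∀ {k w} → CollidingPair k w → T (suc k) ≢ T (suc w)
  CollidingPair⇒T≢ (inj₁ (refl , refl)) T≡ =
    T-m≢T-m+p (trans (cong T (sym (suc-∸1 m≥1))) (trans T≡ (cong T (suc-∸1 m+p≥1))))
  CollidingPair⇒T≢ (inj₂ (refl , refl)) T≡ =
    T-m≢T-m+p (trans (cong T (sym (suc-∸1 m≥1))) (trans (sym T≡) (cong T (suc-∸1 m+p≥1))))

  T-colliding-shortfall : ∀ {k w} → CollidingPair k w → T (suc w) < T (suc k) → T (suc w) ≡ tmin m p t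
  T-colliding-shortfall (inj₁ (refl , refl)) Tw<Tk rewrite T-suc-m∸1 | T-suc-m+p∸1 = sym (m≥n⇒m⊓n≡n (<⇒≤ Tw<Tk))
  T-colliding-shortfall (inj₂ (refl , refl)) Tw<Tk rewrite T-suc-m∸1 | T-suc-m+p∸1 = sym (m≤n⇒m⊓n≡m (<⇒≤ Tw<Tk))

  Φ : ℕ → List ℕ
  Φ = φ m p t

  Φ* : List ℕ → List ℕ
  Φ* = φ* m p t

  Φ*-++ : ∀ xs ys → Φ* (xs ++ ys) ≡ Φ* xs ++ Φ* ys
  Φ*-++ = concatMap-++ Φ

  Φ-++ : ∀ k xs → Φ k ++ xs ≡ replicate (T (suc k)) 0 ++ k ⊕1 ∷ xs
  Φ-++ k xs = ++-assoc (replicate (T (suc k)) 0) [ k ⊕1 ] xs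

  Φ-++≢[] : ∀ k xs → Φ k ++ xs ≢ []
  Φ-++≢[] k xs e = case ++-conicalʳ (replicate (T (suc k)) 0) [ k ⊕1 ] (++-conicalˡ (Φ k) xs e) of λ ()

  Φ-++-injective : ∀ {k w xs ys} → k < m + p → w < m + p → Φ k ++ xs ≡ Φ w ++ ys → k ≡ w × xs ≡ ys
  Φ-++-injective {k} {w} {xs} {ys} k< w< e
    with T≡ , e′ ← replicate-0-cancelˡ (T (suc k)) (T (suc w)) (⊕1≢0 k) (⊕1≢0 w)
                     (trans (sym (Φ-++ k xs)) (trans e (Φ-++ w ys)))
    with ⊕1≡ , xs≡ys ← ∷-injective e′
    with k ≟ w
  ... | yes k≡w = k≡w , xs≡ys
  ... | no  k≢w = contradiction T≡ (CollidingPair⇒T≢ (proj₁ (⊕1-collision k< w< k≢w ⊕1≡)))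

  Φ*-injective : ∀ {xs ys} → All (_< m + p) xs → All (_< m + p) ys → Φ* xs ≡ Φ* ys → xs ≡ ys
  Φ*-injective []        []        _ = refl
  Φ*-injective []        (_ ∷ _)   e = contradiction (sym e) (Φ-++≢[] _ _)
  Φ*-injective (_ ∷ _)   []        e = contradiction e (Φ-++≢[] _ _)
  Φ*-injective (k< ∷ xs) (w< ∷ ys) e with refl , e′ ← Φ-++-injective k< w< e =
    cong (_ ∷_) (Φ*-injective xs ys e′)

  LastNonzero-Φ* : ∀ xs → LastNonzero (Φ* xs)
  LastNonzero-Φ* []       = record {}
  LastNonzero-Φ* (k ∷ xs) =
    LastNonzero-++ (Φ k) (Φ* xs) (LastNonzero-zerosThen (T (suc k)) (⊕1≢0 k)) (LastNonzero-Φ* xs)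

  Φ*-Prefix : ∀ {xs ys} → Prefix xs ys → Prefix (Φ* xs) (Φ* ys)
  Φ*-Prefix {xs} (zs , refl) = Φ* zs , Φ*-++ xs zs

  length-Φ : ∀ k → length (Φ k) ≡ suc (T (suc k))
  length-Φ k = trans (length-++ (replicate (T (suc k)) 0)) (trans (cong (_+ 1) (length-replicate (T (suc k)))) (+-comm _ 1))

  <length-Φ⇒≤T : ∀ {k r} → r < length (Φ k) → r ≤ T (suc k)
  <length-Φ⇒≤T {k} {r} r< = ≤-pred (subst (r <_) (length-Φ k) r<)

  Φ-split : ∀ k {r} → r ≤ T (suc k) → Φ k ≡ replicate r 0 ++ zerosThen (T (suc k) ∸ r) (k ⊕1)
  Φ-split k {r} r≤T = begin
    replicate (T (suc k)) 0 ++ [ k ⊕1 ]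
      ≡⟨ cong (λ n → replicate n 0 ++ [ k ⊕1 ]) (sym (m+[n∸m]≡n r≤T)) ⟩
    replicate (r + (T (suc k) ∸ r)) 0 ++ [ k ⊕1 ]             ≡⟨ cong (_++ [ k ⊕1 ]) (replicate-+ r _ 0) ⟩
    (replicate r 0 ++ replicate (T (suc k) ∸ r) 0) ++ [ k ⊕1 ] ≡⟨ ++-assoc (replicate r 0) _ _ ⟩
    replicate r 0 ++ zerosThen (T (suc k) ∸ r) (k ⊕1)         ∎
    where open ≡-Reasoning

  length-Φ* : ∀ xs → length xs ≤ length (Φ* xs)
  length-Φ* []       = z≤n
  length-Φ* (k ∷ xs) = begin
    suc (length xs)                   ≤⟨ s≤s (≤-trans (length-Φ* xs) (m≤n+m _ (T (suc k)))) ⟩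
    suc (T (suc k) + length (Φ* xs))  ≡⟨ cong (_+ length (Φ* xs)) (length-Φ k) ⟨
    length (Φ k) + length (Φ* xs)     ≡⟨ length-++ (Φ k) ⟨
    length (Φ k ++ Φ* xs)             ∎
    where open ≤-Reasoning

  T₁ : T 1 ≡ t 1
  T₁ = T-low m+p≥1

  T₁≥1 : 1 ≤ T 1
  T₁≥1 = subst (1 ≤_) (sym T₁) (≤-trans (s≤s z≤n) t₁≥2)

  W : ℕ → List ℕ
  W n = iter Φ* n [ 0 ]

  W-Prefix-suc : ∀ n → Prefix (W n) (W (suc n))
  W-Prefix-suc zero = Prefix-trans (starts-with-0 (T 1) T₁≥1) ([] , refl)
    where
    starts-with-0 : ∀ n {xs} → 1 ≤ n → Prefix [ 0 ] (replicate n 0 ++ xs)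
    starts-with-0 (suc n) {xs} _ = replicate n 0 ++ xs , refl
  W-Prefix-suc (suc n) = Φ*-Prefix (W-Prefix-suc n)

  W-Prefix : ∀ n k → Prefix (W n) (W (k + n))
  W-Prefix n zero    = [] , sym (++-identityʳ (W n))
  W-Prefix n (suc k) = Prefix-trans (W-Prefix n k) (W-Prefix-suc (k + n))

  W-length : ∀ n → n < length (W n)
  W-length zero = s≤s z≤n
  W-length (suc n) with zs , eq ← subst (Prefix [ 0 ] ∘′ W) (+-identityʳ n) (W-Prefix 0 n) = begin-strict
    suc n                                ≤⟨ subst (λ ws → n < length ws) eq (W-length n) ⟩
    suc (length zs)                      ≤⟨ s≤s (length-Φ* zs) ⟩
    suc (length (Φ* zs))                 <⟨ s≤s (+-monoˡ-≤ (length (Φ* zs)) T₁≥1) ⟩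
    suc (T 1 + length (Φ* zs))           ≡⟨ cong (_+ length (Φ* zs)) (length-Φ 0) ⟨
    length (Φ 0) + length (Φ* zs)        ≡⟨ length-++ (Φ 0) ⟨
    length (Φ* (0 ∷ zs))                 ≡⟨ cong (length ∘′ Φ*) eq ⟨
    length (W (suc n))                   ∎
    where open ≤-Reasoning

  All-Φ* : ∀ xs → All (_< m + p) (Φ* xs)
  All-Φ* []       = []
  All-Φ* (k ∷ xs) = ++⁺ (++⁺ (replicate⁺ (T (suc k)) (≤-trans (s≤s z≤n) m+p≥1)) (⊕1<m+p k ∷ [])) (All-Φ* xs)

  opaque
    U : ℕ → ℕ
    U = u m p t

    U-W : ∀ j → U j ≡ nth (W (suc j)) j
    U-W j = refl

    U-u : ∀ j → U j ≡ u m p t j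
    U-u j = refl

  U-nth : ∀ n j → j < length (W n) → U j ≡ nth (W n) j
  U-nth n j j< with ≤-total n (suc j)
  ... | inj₁ n≤ = trans (U-W j) (subst (λ i → nth (W i) j ≡ nth (W n) j) (m∸n+n≡m n≤)
                                   (Prefix-nth j (W-Prefix n (suc j ∸ n)) j<))
  ... | inj₂ n≥ = trans (U-W j) (sym (subst (λ i → nth (W i) j ≡ nth (W (suc j)) j) (m∸n+n≡m n≥)
                                   (Prefix-nth j (W-Prefix (suc j) (n ∸ suc j)) (<⇒≤ (W-length (suc j))))))

  U<m+p : ∀ j → U j < m + p
  U<m+p j = subst (_< m + p) (sym (U-W j)) (All-nth j (All-Φ* (W j)) (<⇒≤ (W-length (suc j))))

  seg : ℕ → ℕ → List ℕ
  seg i zero    = []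
  seg i (suc n) = U i ∷ seg (suc i) n

  length-seg : ∀ i n → length (seg i n) ≡ n
  length-seg i zero    = refl
  length-seg i (suc n) = cong suc (length-seg (suc i) n)

  seg-+ : ∀ i n k → seg i (n + k) ≡ seg i n ++ seg (i + n) k
  seg-+ i zero    k = cong (λ j → seg j k) (sym (+-identityʳ i))
  seg-+ i (suc n) k = cong (U i ∷_) (trans (seg-+ (suc i) n k) (cong (λ j → seg (suc i) n ++ seg j k) (sym (+-suc i n))))

  seg-∷ʳ : ∀ i n → seg i (suc n) ≡ seg i n ++ [ U (i + n) ]
  seg-∷ʳ i n = trans (cong (seg i) (+-comm 1 n)) (seg-+ i n 1)

  seg-≡ : ∀ i {xs} → (∀ j → j < length xs → U (i + j) ≡ nth xs j) → seg i (length xs) ≡ xs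
  seg-≡ i {[]}     _  = refl
  seg-≡ i {x ∷ xs} eq = cong₂ _∷_ (trans (cong U (sym (+-identityʳ i))) (eq 0 (s≤s z≤n)))
    (seg-≡ (suc i) (λ j j< → trans (cong U (sym (+-suc i j))) (eq (suc j) (s≤s j<))))

  seg-upTo : ∀ i n → map (λ j → u m p t (i + j)) (upTo n) ≡ seg i n
  seg-upTo i n = trans (map-applyUpTo (λ j → j) (λ j → u m p t (i + j)) n) (applyUpTo-seg i n λ j → sym (U-u (i + j)))
    where
    applyUpTo-seg : ∀ i n {f} → (∀ j → f j ≡ U (i + j)) → applyUpTo f n ≡ seg i n
    applyUpTo-seg i zero    _  = refl
    applyUpTo-seg i (suc n) eq = cong₂ _∷_ (trans (eq 0) (cong U (+-identityʳ i)))
      (applyUpTo-seg (suc i) n λ j → trans (eq (suc j)) (cong U (+-suc i j)))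

  All-seg : ∀ i n → All (_< m + p) (seg i n)
  All-seg i zero    = []
  All-seg i (suc n) = U<m+p i ∷ All-seg (suc i) n

  seg-Prefix-W : ∀ n k → k ≤ length (W n) → Prefix (seg 0 k) (W n)
  seg-Prefix-W n zero    _  = W n , refl
  seg-Prefix-W n (suc k) k< with seg-Prefix-W n k (<⇒≤ k<)
  ... | [] , eq = contradiction
    (trans (cong length eq) (trans (length-++ (seg 0 k)) (trans (+-identityʳ _) (length-seg 0 k)))) (>⇒≢ k<)
  ... | x ∷ zs , eq = zs , (begin
    W n                       ≡⟨ eq ⟩
    seg 0 k ++ x ∷ zs         ≡⟨ cong (λ y → seg 0 k ++ y ∷ zs) (sym U-k≡x) ⟩
    seg 0 k ++ U k ∷ zs       ≡⟨ ++-assoc (seg 0 k) [ U k ] zs ⟨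
    (seg 0 k ++ [ U k ]) ++ zs ≡⟨ cong (_++ zs) (seg-∷ʳ 0 k) ⟨
    seg 0 (suc k) ++ zs       ∎)
    where
    open ≡-Reasoning
    U-k≡x : U k ≡ x
    U-k≡x = begin
      U k                           ≡⟨ U-nth n k k< ⟩
      nth (W n) k                   ≡⟨ cong (λ ws → nth ws k) eq ⟩
      nth (seg 0 k ++ x ∷ zs) k     ≡⟨ cong (nth (seg 0 k ++ x ∷ zs)) (trans (sym (length-seg 0 k)) (sym (+-identityʳ _))) ⟩
      nth (seg 0 k ++ x ∷ zs) (length (seg 0 k) + 0) ≡⟨ nth-++ʳ (seg 0 k) (x ∷ zs) 0 ⟩
      x                             ∎

  -- where the block φ(u_N) starts in u = φ(u)
  pos : ℕ → ℕ
  pos N = length (Φ* (seg 0 N))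

  U-block : ∀ N {r} → r < length (Φ (U N)) → U (pos N + r) ≡ nth (Φ (U N)) r
  U-block N {r} r< with zs , eq ← seg-Prefix-W (suc N) (suc N) (<⇒≤ (W-length (suc N))) = begin
    U (pos N + r)                                      ≡⟨ U-nth (suc (suc N)) (pos N + r) in-range ⟩
    nth (W (suc (suc N))) (pos N + r)                  ≡⟨ cong (λ ws → nth ws (pos N + r)) W≡ ⟩
    nth (Φ* (seg 0 N) ++ Φ (U N) ++ Φ* zs) (pos N + r) ≡⟨ nth-++ʳ (Φ* (seg 0 N)) _ r ⟩
    nth (Φ (U N) ++ Φ* zs) r                           ≡⟨ nth-++ˡ (Φ (U N)) (Φ* zs) r< ⟩
    nth (Φ (U N)) r                                    ∎
    where
    open ≡-Reasoning
    W≡ : W (suc (suc N)) ≡ Φ* (seg 0 N) ++ Φ (U N) ++ Φ* zs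
    W≡ = begin
      Φ* (W (suc N))                  ≡⟨ cong Φ* eq ⟩
      Φ* (seg 0 (suc N) ++ zs)        ≡⟨ cong (λ ws → Φ* (ws ++ zs)) (seg-∷ʳ 0 N) ⟩
      Φ* ((seg 0 N ++ [ U N ]) ++ zs) ≡⟨ cong Φ* (++-assoc (seg 0 N) [ U N ] zs) ⟩
      Φ* (seg 0 N ++ U N ∷ zs)        ≡⟨ Φ*-++ (seg 0 N) (U N ∷ zs) ⟩
      Φ* (seg 0 N) ++ Φ (U N) ++ Φ* zs ∎
    in-range : pos N + r < length (W (suc (suc N)))
    in-range = subst (λ ws → pos N + r < length ws) (sym W≡)
      (subst (pos N + r <_) (sym (length-++ (Φ* (seg 0 N))))
        (+-monoʳ-< (pos N) (subst (r <_) (sym (length-++ (Φ (U N)))) (≤-trans r< (m≤m+n _ _)))))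

  pos-+ : ∀ A k → pos (A + k) ≡ pos A + length (Φ* (seg A k))
  pos-+ A k = trans (cong (length ∘′ Φ*) (seg-+ 0 A k))
                    (trans (cong length (Φ*-++ (seg 0 A) (seg A k))) (length-++ (Φ* (seg 0 A))))

  pos-suc : ∀ N → pos (suc N) ≡ pos N + length (Φ (U N))
  pos-suc N = trans (cong pos (+-comm 1 N)) (trans (pos-+ N 1) (cong (λ xs → pos N + length xs) (++-identityʳ (Φ (U N)))))

  pos-<-suc : ∀ N → pos N < pos (suc N)
  pos-<-suc N = subst (pos N <_) (sym (pos-suc N)) (subst (_≤ pos N + length (Φ (U N))) (+-comm (pos N) 1)
                  (+-monoʳ-≤ (pos N) (subst (1 ≤_) (sym (length-Φ (U N))) (s≤s z≤n))))

  pos-mono : ∀ {A B} → A ≤ B → pos A ≤ pos B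
  pos-mono {A} {B} A≤B =
    subst (λ C → pos A ≤ pos C) (m+[n∸m]≡n A≤B) (subst (pos A ≤_) (sym (pos-+ A (B ∸ A))) (m≤m+n _ _))

  N≤pos : ∀ N → N ≤ pos N
  N≤pos zero    = z≤n
  N≤pos (suc N) = ≤-trans (s≤s (N≤pos N)) (pos-<-suc N)

  -- Needs t₁ ≥ 2 (φ(u₀) = 0^{t₁} 1); it makes desubstitution move occurrences strictly to the left.
  2+N<pos-suc : ∀ N → suc (suc N) < pos (suc N)
  2+N<pos-suc zero = subst (2 <_) (sym pos₁) (s≤s (subst (2 ≤_) (sym T₁) t₁≥2))
    where
    U₀ : U 0 ≡ 0
    U₀ = U-nth 0 0 (s≤s z≤n)
    pos₁ : pos 1 ≡ suc (T 1)
    pos₁ = trans (pos-suc 0) (trans (length-Φ (U 0)) (cong (λ k → suc (T (suc k))) U₀))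
  2+N<pos-suc (suc N) = ≤-trans (s≤s (2+N<pos-suc N)) (pos-<-suc (suc N))

  locate : ∀ j → ∃[ N ] ∃[ r ] (j ≡ pos N + r × r < length (Φ (U N)))
  locate zero = 0 , 0 , refl , subst (0 <_) (sym (length-Φ (U 0))) (s≤s z≤n)
  locate (suc j) with locate j
  ... | N , r , refl , r< with suc r <? length (Φ (U N))
  ...   | yes r+1< = N , suc r , sym (+-suc (pos N) r) , r+1<
  ...   | no  r+1≮ = suc N , 0 , next-block , subst (0 <_) (sym (length-Φ (U (suc N)))) (s≤s z≤n)
    where
    next-block : suc (pos N + r) ≡ pos (suc N) + 0
    next-block = trans (sym (+-suc (pos N) r)) (trans (cong (pos N +_) (≤-antisym r< (≮⇒≥ r+1≮)))
                   (trans (sym (pos-suc N)) (sym (+-identityʳ _))))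

  seg-block : ∀ N → seg (pos N) (length (Φ (U N))) ≡ Φ (U N)
  seg-block N = seg-≡ (pos N) (λ _ → U-block N)

  seg-blocks : ∀ A k → seg (pos A) (length (Φ* (seg A k))) ≡ Φ* (seg A k)
  seg-blocks A zero    = refl
  seg-blocks A (suc k) = begin
    seg (pos A) (length (Φ (U A) ++ Φ* ws))              ≡⟨ cong (seg (pos A)) (length-++ (Φ (U A))) ⟩
    seg (pos A) (length (Φ (U A)) + length (Φ* ws))      ≡⟨ seg-+ (pos A) (length (Φ (U A))) _ ⟩
    seg (pos A) (length (Φ (U A))) ++ seg (pos A + length (Φ (U A))) (length (Φ* ws))
      ≡⟨ cong₂ _++_ (seg-block A) (cong (λ i → seg i (length (Φ* ws))) (sym (pos-suc A))) ⟩
    Φ (U A) ++ seg (pos (suc A)) (length (Φ* ws))        ≡⟨ cong (Φ (U A) ++_) (seg-blocks (suc A) k) ⟩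
    Φ (U A) ++ Φ* ws                                    ∎
    where
    open ≡-Reasoning
    ws : List ℕ
    ws = seg (suc A) k

  seg-zeros : ∀ N r n → r + n ≤ T (suc (U N)) → seg (pos N + r) n ≡ replicate n 0
  seg-zeros N r n r+n≤ =
    subst (λ k → seg (pos N + r) k ≡ replicate n 0) (length-replicate n) (seg-≡ (pos N + r) zero-at)
    where
    zero-at : ∀ j → j < length (replicate n 0) → U (pos N + r + j) ≡ nth (replicate n 0) j
    zero-at j j< with j<n ← subst (j <_) (length-replicate n) j< = begin
      U (pos N + r + j)           ≡⟨ cong U (+-assoc (pos N) r j) ⟩
      U (pos N + (r + j))         ≡⟨ U-block N (subst (r + j <_) (sym (length-Φ (U N))) (m≤n⇒m≤1+n r+j<)) ⟩
      nth (Φ (U N)) (r + j)       ≡⟨ nth-replicate-++ _ _ r+j< ⟩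
      0                           ≡⟨ nth-replicate-++ n [] j<n ⟨
      nth (replicate n 0 ++ []) j ≡⟨ cong (λ xs → nth xs j) (++-identityʳ (replicate n 0)) ⟩
      nth (replicate n 0) j       ∎
      where
      open ≡-Reasoning
      r+j< : r + j < T (suc (U N))
      r+j< = ≤-trans (+-monoʳ-< r j<n) r+n≤

  seg-block-suffix : ∀ N r {xs} → Φ (U N) ≡ replicate r 0 ++ xs → seg (pos N + r) (length xs) ≡ xs
  seg-block-suffix N r {xs} Φ≡ = seg-≡ (pos N + r) λ j j< → begin
    U (pos N + r + j)                      ≡⟨ cong U (+-assoc (pos N) r j) ⟩
    U (pos N + (r + j))                    ≡⟨ U-block N (subst (r + j <_) (sym (cong length Φ≡)) (in-range j<)) ⟩
    nth (Φ (U N)) (r + j)                  ≡⟨ cong (λ ys → nth ys (r + j)) Φ≡ ⟩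
    nth (replicate r 0 ++ xs) (r + j)      ≡⟨ cong (nth (replicate r 0 ++ xs)) (cong (_+ j) (sym (length-replicate r))) ⟩
    nth (replicate r 0 ++ xs) (length (replicate r 0) + j) ≡⟨ nth-++ʳ (replicate r 0) xs j ⟩
    nth xs j                               ∎
    where
    open ≡-Reasoning
    in-range : ∀ {j} → j < length xs → r + j < length (replicate r 0 ++ xs)
    in-range j< = subst (_ <_) (sym (trans (length-++ (replicate r 0)) (cong (_+ length xs) (length-replicate r))))
                        (+-monoʳ-< r j<)

  record BlockTail (N d : ℕ) : Set where
    field
      K r   : ℕ
      r<    : r < length (Φ (U (N + K)))
      seg≡  : seg (pos N) d ≡ Φ* (seg N K) ++ replicate r 0
      next≡ : U (pos N + d) ≡ nth (Φ (U (N + K))) r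

  blockTail : ∀ N d → BlockTail N d
  blockTail N d with locate (pos N + d)
  ... | N′ , r , at , r′< = record
    { K = K ; r = r ; r< = r< ; seg≡ = seg≡
    ; next≡ = trans (cong U at′) (U-block (N + K) r<) }
    where
    N≤N′ : N ≤ N′
    N≤N′ = ≮⇒≥ λ N′<N → <-irrefl (sym at) (begin-strict
      pos N′ + r                 <⟨ +-monoʳ-< (pos N′) r′< ⟩
      pos N′ + length (Φ (U N′)) ≡⟨ pos-suc N′ ⟨
      pos (suc N′)               ≤⟨ pos-mono N′<N ⟩
      pos N                      ≤⟨ m≤m+n (pos N) d ⟩
      pos N + d                  ∎)
      where open ≤-Reasoning
    K : ℕ
    K = N′ ∸ N
    N+K≡N′ : N + K ≡ N′
    N+K≡N′ = m+[n∸m]≡n N≤N′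
    r< : r < length (Φ (U (N + K)))
    r< = subst (λ n → r < length (Φ (U n))) (sym N+K≡N′) r′<
    at′ : pos N + d ≡ pos (N + K) + r
    at′ = trans at (cong (λ n → pos n + r) (sym N+K≡N′))
    d≡ : d ≡ length (Φ* (seg N K)) + r
    d≡ = +-cancelˡ-≡ (pos N) _ _ (trans at′ (trans (cong (_+ r) (pos-+ N K)) (+-assoc (pos N) _ r)))
    seg≡ : seg (pos N) d ≡ Φ* (seg N K) ++ replicate r 0
    seg≡ = begin
      seg (pos N) d                                                      ≡⟨ cong (seg (pos N)) d≡ ⟩
      seg (pos N) (length (Φ* (seg N K)) + r)                            ≡⟨ seg-+ (pos N) _ r ⟩
      seg (pos N) (length (Φ* (seg N K))) ++ seg (pos N + length (Φ* (seg N K))) r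
        ≡⟨ cong₂ _++_ (seg-blocks N K) (trans (cong (λ i → seg i r) (trans (sym (pos-+ N K)) (sym (+-identityʳ _))))
                                              (seg-zeros (N + K) 0 r (<length-Φ⇒≤T r<))) ⟩
      Φ* (seg N K) ++ replicate r 0                                      ∎
      where open ≡-Reasoning

  record Occ (a : ℕ) (v : List ℕ) (c i : ℕ) : Set where
    field
      left≡  : U i ≡ a
      seg≡   : seg (suc i) (length v) ≡ v
      right≡ : U (suc i + length v) ≡ c

  seg-around : ∀ i {a c : ℕ} (v : List ℕ) →
    seg i (length (a ∷ v ++ [ c ])) ≡ U i ∷ seg (suc i) (length v) ++ [ U (suc i + length v) ]
  seg-around i {c = c} v = cong (U i ∷_) (trans (cong (seg (suc i)) (length-++ v {[ c ]})) (seg-+ (suc i) (length v) 1))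

  Factor⇒Occ : ∀ {a v c} → Factor m p t (a ∷ v ++ [ c ]) → ∃[ i ] Occ a v c i
  Factor⇒Occ {a} {v} {c} (i , w≡)
    with a≡ , rest ← ∷-injective (trans (sym (seg-around i {a} {c} v)) (sym (trans w≡ (seg-upTo i _))))
    with v≡ , c≡ ← ++-cancel-≡-length (seg (suc i) (length v)) v (length-seg (suc i) (length v)) rest =
    i , record { left≡ = a≡ ; seg≡ = v≡ ; right≡ = proj₁ (∷-injective c≡) }

  Occ⇒Factor : ∀ {a v c i} → Occ a v c i → Factor m p t (a ∷ v ++ [ c ])
  Occ⇒Factor {a} {v} {c} {i} occ = i , sym (begin
    map (λ j → u m p t (i + j)) (upTo (length (a ∷ v ++ [ c ]))) ≡⟨ seg-upTo i _ ⟩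
    seg i (length (a ∷ v ++ [ c ]))                             ≡⟨ seg-around i {a} {c} v ⟩
    U i ∷ seg (suc i) (length v) ++ [ U (suc i + length v) ]
      ≡⟨ cong₂ _∷_ left≡ (cong₂ (λ ys y → ys ++ [ y ]) seg≡ right≡) ⟩
    a ∷ v ++ [ c ]                                              ∎)
    where
    open ≡-Reasoning
    open Occ occ

  Occ-prefix : ∀ {a xs y ys c i} → Occ a (xs ++ y ∷ ys) c i → Occ a xs y i
  Occ-prefix {a} {xs} {y} {ys} {c} {i} occ =
    record { left≡ = left≡ ; seg≡ = proj₁ cancelled ; right≡ = proj₁ (∷-injective (proj₂ cancelled)) }
    where
    open Occ occ
    split : seg (suc i) (length xs) ++ seg (suc i + length xs) (length (y ∷ ys)) ≡ xs ++ y ∷ ys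
    split = trans (sym (seg-+ (suc i) (length xs) _)) (trans (cong (seg (suc i)) (sym (length-++ xs))) seg≡)
    cancelled : seg (suc i) (length xs) ≡ xs × seg (suc i + length xs) (length (y ∷ ys)) ≡ y ∷ ys
    cancelled = ++-cancel-≡-length _ xs (length-seg (suc i) (length xs)) split

  Occ-split : ∀ {a v c i} n → Occ a v c i → n ≤ length v →
    v ≡ seg (suc i) n ++ seg (suc i + n) (length v ∸ n) × U (suc i + n + (length v ∸ n)) ≡ c
  Occ-split {v = v} {i = i} n occ n≤v =
    trans (sym seg≡) (trans (cong (seg (suc i)) (sym (m+[n∸m]≡n n≤v))) (seg-+ (suc i) n _)) ,
    trans (cong U (trans (+-assoc (suc i) n _) (cong (suc i +_) (m+[n∸m]≡n n≤v)))) right≡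
    where open Occ occ

  ShortZeroRun : List ℕ → Set
  ShortZeroRun v = v ≡ replicate (length v) 0 × length v < t 1

  -- Position i lies in the block φ(u_N), at its last letter or at one of its zeros;
  -- X is the rest of that block.
  data LeftEnd (a i N : ℕ) (X : List ℕ) : Set where
    boundary : X ≡ [] → a ≡ U N ⊕1 → suc (suc N) ≤ i → LeftEnd a i N X
    interior : ∀ s → X ≡ zerosThen s (U N ⊕1) → a ≡ 0 → s < T (suc (U N)) → N ≤ i → LeftEnd a i N X

  LastNonzero-LeftEnd : ∀ {a i N X} → LeftEnd a i N X → LastNonzero X
  LastNonzero-LeftEnd (boundary refl _ _)     = record {}
  LastNonzero-LeftEnd (interior s refl _ _ _) = LastNonzero-zerosThen s (⊕1≢0 _)

  record LeftCut (a : ℕ) (v : List ℕ) (c i : ℕ) : Set where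
    field
      N d : ℕ
      X   : List ℕ
      end : LeftEnd a i N X
      v≡  : v ≡ X ++ seg (pos (suc N)) d
      c≡  : U (pos (suc N) + d) ≡ c

  cut-at-block-end : ∀ {a v c} N → Occ a v c (pos N + T (suc (U N))) → LeftCut a v c (pos N + T (suc (U N)))
  cut-at-block-end {a} {v} {c} N occ = record
    { N = N ; d = length v ; X = []
    ; end = boundary refl a≡ (≤-pred (subst (suc (suc (suc N)) ≤_) (sym next) (2+N<pos-suc N)))
    ; v≡ = trans (sym seg≡) (cong (λ j → seg j (length v)) next)
    ; c≡ = trans (cong (λ j → U (j + length v)) (sym next)) right≡ }
    where
    open Occ occ
    T′ : ℕ
    T′ = T (suc (U N))
    next : suc (pos N + T′) ≡ pos (suc N)
    next = trans (sym (+-suc (pos N) T′)) (trans (cong (pos N +_) (sym (length-Φ (U N)))) (sym (pos-suc N)))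
    a≡ : a ≡ U N ⊕1
    a≡ = trans (sym left≡) (trans (U-block N (subst (T′ <_) (sym (length-Φ (U N))) ≤-refl))
                                   (nth-zerosThen-last T′ (U N ⊕1)))

  cut-inside-block : ∀ {a v c} N {r₁} → r₁ < T (suc (U N)) → Occ a v c (pos N + r₁) → ¬ ShortZeroRun v →
    LeftCut a v c (pos N + r₁)
  cut-inside-block {a} {v} {c} N {r₁} r₁<T occ not-short with suc r₁ + length v ≤? T (suc (U N))
  ... | yes inside = contradiction (zeros , short) not-short
    where
    open Occ occ
    zeros : v ≡ replicate (length v) 0
    zeros = trans (sym seg≡) (trans (cong (λ j → seg j (length v)) (sym (+-suc (pos N) r₁)))
                                    (seg-zeros N (suc r₁) (length v) inside))
    short : length v < t 1
    short = ≤-trans (<-≤-trans (m<n+m (length v) (s≤s z≤n)) inside) (T-suc≤t₁ (U N))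
  ... | no  outside = record
    { N = N ; d = length v ∸ length X ; X = X
    ; end = interior s refl a≡0 s<T (≤-trans (N≤pos N) (m≤m+n (pos N) r₁))
    ; v≡ = trans (proj₁ split) (cong₂ _++_ (trans (cong (λ j → seg j (length X)) i+1≡) (seg-block-suffix N (suc r₁) Φ≡))
                                           (cong (λ j → seg j (length v ∸ length X)) next))
    ; c≡ = trans (cong (λ j → U (j + (length v ∸ length X))) (sym next)) (proj₂ split) }
    where
    open Occ occ
    T′ s : ℕ
    T′ = T (suc (U N))
    s  = T′ ∸ suc r₁
    X : List ℕ
    X = zerosThen s (U N ⊕1)
    s<T : s < T′
    s<T = subst (suc s ≤_) (m+[n∸m]≡n r₁<T) (s≤s (m≤n+m s r₁))
    a≡0 : a ≡ 0
    a≡0 = trans (sym left≡) (trans (U-block N (subst (r₁ <_) (sym (length-Φ (U N))) (m≤n⇒m≤1+n r₁<T)))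
                                   (nth-replicate-++ T′ _ r₁<T))
    Φ≡ : Φ (U N) ≡ replicate (suc r₁) 0 ++ X
    Φ≡ = Φ-split (U N) r₁<T
    length-Φ≡ : length (Φ (U N)) ≡ suc r₁ + length X
    length-Φ≡ = trans (cong length Φ≡)
                  (trans (length-++ (replicate (suc r₁) 0)) (cong (_+ length X) (length-replicate (suc r₁))))
    X≤v : length X ≤ length v
    X≤v = +-cancelˡ-≤ (suc r₁) _ _ (subst (_≤ suc r₁ + length v) (trans (sym (length-Φ (U N))) length-Φ≡) (≰⇒> outside))
    split : v ≡ seg (suc (pos N + r₁)) (length X) ++ seg (suc (pos N + r₁) + length X) (length v ∸ length X) ×
            U (suc (pos N + r₁) + length X + (length v ∸ length X)) ≡ c
    split = Occ-split (length X) occ X≤v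
    i+1≡ : suc (pos N + r₁) ≡ pos N + suc r₁
    i+1≡ = sym (+-suc (pos N) r₁)
    next : suc (pos N + r₁) + length X ≡ pos (suc N)
    next = trans (cong (_+ length X) i+1≡)
             (trans (+-assoc (pos N) (suc r₁) _) (trans (cong (pos N +_) (sym length-Φ≡)) (sym (pos-suc N))))

  leftCut : ∀ {a v c i} → Occ a v c i → ¬ ShortZeroRun v → LeftCut a v c i
  leftCut {i = i} occ not-short with locate i
  ... | N , r₁ , refl , r₁< with m≤n⇒m<n∨m≡n (<length-Φ⇒≤T r₁<)
  ...   | inj₁ r₁<T = cut-inside-block N r₁<T occ not-short
  ...   | inj₂ refl = cut-at-block-end N occ

  record Parse (a : ℕ) (v : List ℕ) (c i : ℕ) : Set where
    field
      N K r : ℕ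
      X     : List ℕ
      end   : LeftEnd a i N X
      r<    : r < length (Φ (U (suc N + K)))
      v≡    : v ≡ X ++ Φ* (seg (suc N) K) ++ replicate r 0
      c≡    : c ≡ nth (Φ (U (suc N + K))) r

  parse : ∀ {a v c i} → Occ a v c i → ¬ ShortZeroRun v → Parse a v c i
  parse {a} {v} {c} {i} occ not-short = record
    { N = N ; K = K ; r = r ; X = X ; end = end ; r< = r<
    ; v≡ = trans v≡ (cong (X ++_) seg≡)
    ; c≡ = trans (sym c≡) next≡ }
    where
    open LeftCut (leftCut occ not-short)
    open BlockTail (blockTail (suc N) d)

  Occ-seg : ∀ j K → Occ (U j) (seg (suc j) K) (U (suc j + K)) j
  Occ-seg j K = record
    { left≡ = refl
    ; seg≡ = cong (seg (suc j)) (length-seg (suc j) K)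
    ; right≡ = cong (λ n → U (suc j + n)) (length-seg (suc j) K) }

  isColliding : ℕ → ℕ → Bool
  isColliding a b = (⌊ a ≟ m ∸ 1 ⌋ ∧ ⌊ b ≟ m + p ∸ 1 ⌋) ∨ (⌊ a ≟ m + p ∸ 1 ⌋ ∧ ⌊ b ≟ m ∸ 1 ⌋)

  isColliding≡does : ∀ a b → isColliding a b ≡ does (CollidingPair? a b)
  isColliding≡does a b =
    cong₂ _∨_ (cong₂ _∧_ (isYes≗does (a ≟ m ∸ 1)) (isYes≗does (b ≟ m + p ∸ 1)))
              (cong₂ _∧_ (isYes≗does (a ≟ m + p ∸ 1)) (isYes≗does (b ≟ m ∸ 1)))

  isColliding-true : ∀ {a b} → CollidingPair a b → isColliding a b ≡ true
  isColliding-true {a} {b} col = trans (isColliding≡does a b) (dec-true (CollidingPair? a b) col)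

  isColliding-false : ∀ {a b} → ¬ CollidingPair a b → isColliding a b ≡ false
  isColliding-false {a} {b} ¬col = trans (isColliding≡does a b) (dec-false (CollidingPair? a b) ¬col)

  leftLetters : ℕ → ℕ → ℕ → ℕ × ℕ
  leftLetters z a b =
    (if isColliding a b then (if ⌊ T (suc b) <? T (suc a) ⌋ then 0 else z) else a ⊕1) ,
    (if isColliding a b then (if ⌊ T (suc b) <? T (suc a) ⌋ then z else 0) else b ⊕1)

  rightLetter : ℕ → ℕ → ℕ
  rightLetter μ c = if ⌊ μ <? T (suc c) ⌋ then 0 else c ⊕1

  fstep-≡ : ∀ z {a₀ b₀ c₀ d₀ w a b c d v} → leftLetters z a₀ b₀ ≡ (a , b) →
    rightLetter (T (suc c₀) ⊓ T (suc d₀)) c₀ ≡ c → rightLetter (T (suc c₀) ⊓ T (suc d₀)) d₀ ≡ d →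
    fL m p t a₀ b₀ ++ Φ* w ++ fR m p t c₀ d₀ ≡ v →
    fstep m p t z (a₀ , b₀ , c₀ , d₀ , w) ≡ (a , b , c , d , v)
  fstep-≡ z refl refl refl refl = refl

  leftLetters-noncolliding : ∀ z {a b} → ¬ CollidingPair a b → leftLetters z a b ≡ (a ⊕1 , b ⊕1)
  leftLetters-noncolliding z ¬col rewrite isColliding-false ¬col = refl

  leftLetters-colliding : ∀ z {a b} → CollidingPair a b → T (suc b) < T (suc a) → leftLetters z a b ≡ (0 , z)
  leftLetters-colliding z {a} {b} col Tb<Ta rewrite isColliding-true col | isYes-true (T (suc b) <? T (suc a)) Tb<Ta = refl

  leftLetters-swap : ∀ z a b → leftLetters z b a ≡ swap (leftLetters z a b)
  leftLetters-swap z a b with CollidingPair? a b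
  ... | yes col rewrite isColliding-true col | isColliding-true (CollidingPair-sym col) =
    cong₂ _,_ (if-<-flip 0 z (CollidingPair⇒T≢ col)) (if-<-flip z 0 (CollidingPair⇒T≢ col))
  ... | no ¬col rewrite isColliding-false ¬col | isColliding-false (¬col ∘′ CollidingPair-sym) = refl

  right-extension : ∀ {c d c₀ d₀ r} → r < length (Φ c₀) → r < length (Φ d₀) →
    c ≡ nth (Φ c₀) r → d ≡ nth (Φ d₀) r → c ≢ d →
    c₀ ≢ d₀ ×
    rightLetter (T (suc c₀) ⊓ T (suc d₀)) c₀ ≡ c ×
    rightLetter (T (suc c₀) ⊓ T (suc d₀)) d₀ ≡ d ×
    fR m p t c₀ d₀ ≡ replicate r 0
  right-extension {c₀ = c₀} {d₀} {r} r<c r<d refl refl differ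
    rewrite zerosThen-firstDifference (<length-Φ⇒≤T r<c) (<length-Φ⇒≤T r<d) differ =
    (λ c₀≡d₀ → differ (cong (λ x → nth (Φ x) r) c₀≡d₀)) ,
    sym (nth-zerosThen _ _ (<length-Φ⇒≤T r<c)) , sym (nth-zerosThen _ _ (<length-Φ⇒≤T r<d)) ,
    commonPrefix-zerosThen r (⊕1≢0 c₀) (⊕1≢0 d₀) (<length-Φ⇒≤T r<c) (<length-Φ⇒≤T r<d) differ

  fL-≡[] : ∀ {k w} → k ⊕1 ≢ w ⊕1 → fL m p t k w ≡ []
  fL-≡[] {k} {w} = commonSuffix-zerosThen-≢ (T (suc k)) (T (suc w))

  fL-≡Φ : ∀ {k w} → k ⊕1 ≡ w ⊕1 → T (suc w) ≤ T (suc k) → fL m p t k w ≡ Φ w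
  fL-≡Φ {k} {w} ⊕1≡ T≤ = begin
    commonSuffix (zerosThen (T (suc k)) (k ⊕1)) (Φ w) ≡⟨ cong (λ x → commonSuffix (zerosThen (T (suc k)) x) (Φ w)) ⊕1≡ ⟩
    commonSuffix (zerosThen (T (suc k)) (w ⊕1)) (Φ w) ≡⟨ commonSuffix-zerosThen-≡ (T (suc k)) (T (suc w)) (w ⊕1) ⟩
    zerosThen (T (suc k) ⊓ T (suc w)) (w ⊕1)          ≡⟨ cong (λ n → zerosThen n (w ⊕1)) (m≥n⇒m⊓n≡n T≤) ⟩
    Φ w                                               ∎
    where open ≡-Reasoning

  swapExt : Ext m p t → Ext m p t
  swapExt (a , b , c , d , v) = b , a , d , c , v

  fstep-swap : ∀ z e → fstep m p t z (swapExt e) ≡ swapExt (fstep m p t z e)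
  fstep-swap z (a , b , c , d , v) = fstep-≡ z {w = v} (leftLetters-swap z a b)
    (cong (λ μ → rightLetter μ d) (⊓-comm (T (suc d)) (T (suc c))))
    (cong (λ μ → rightLetter μ c) (⊓-comm (T (suc d)) (T (suc c))))
    (cong₂ (λ l r → l ++ Φ* v ++ r) (commonSuffix-comm (Φ b) (Φ a)) (commonPrefix-comm (Φ d) (Φ c)))

  Φ*-seg-uncons : ∀ j K {s x ys} → x ≢ 0 → zerosThen s x ++ ys ≡ Φ* (seg j K) →
    ∃[ K′ ] (suc K′ ≡ K × s ≡ T (suc (U j)) × x ≡ U j ⊕1 × ys ≡ Φ* (seg (suc j) K′))
  Φ*-seg-uncons j zero    {s} {x} {ys} _ e =
    contradiction (++-conicalʳ (replicate s 0) [ x ] (++-conicalˡ (zerosThen s x) ys e)) λ ()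
  Φ*-seg-uncons j (suc K) {s} {x} {ys} x≢0 e
    with s≡ , e′ ← replicate-0-cancelˡ s (T (suc (U j))) x≢0 (⊕1≢0 (U j))
                     (trans (sym (++-assoc (replicate s 0) [ x ] ys)) (trans e (Φ-++ (U j) _)))
    with x≡ , ys≡ ← ∷-injective e′ = K , refl , s≡ , x≡ , ys≡

  module _ (z : ℕ) (z-spec : IsZ m p t z) where

    z-unique : ∀ {b s x ys d i′} → b ≢ 0 → s ≡ tmin m p t → x ≡ m → Occ b (zerosThen s x ++ ys) d i′ → b ≡ z
    z-unique {b} {s} {x} {ys} {d} {i′} b≢0 refl refl occ =
      proj₂ (proj₂ z-spec) b b≢0
        (Occ⇒Factor (Occ-prefix (subst (λ w → Occ b w d i′) (++-assoc (replicate s 0) [ x ] ys) occ)))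

    record Preimage (a b c d : ℕ) (v : List ℕ) (i i′ : ℕ) : Set where
      field
        a₀ b₀ c₀ d₀ j j′ : ℕ
        w     : List ℕ
        j+j′< : j + j′ < i + i′
        a₀≢b₀ : a₀ ≢ b₀
        c₀≢d₀ : c₀ ≢ d₀
        occ₁  : Occ a₀ w c₀ j
        occ₂  : Occ b₀ w d₀ j′
        image : fstep m p t z (a₀ , b₀ , c₀ , d₀ , w) ≡ (a , b , c , d , v)

    Preimage-swap : ∀ {a b c d v i i′} → Preimage a b c d v i i′ → Preimage b a d c v i′ i
    Preimage-swap {i = i} {i′} P = record
      { a₀ = b₀ ; b₀ = a₀ ; c₀ = d₀ ; d₀ = c₀ ; j = j′ ; j′ = j ; w = w
      ; j+j′< = subst₂ _<_ (+-comm j j′) (+-comm i i′) j+j′<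
      ; a₀≢b₀ = a₀≢b₀ ∘′ sym ; c₀≢d₀ = c₀≢d₀ ∘′ sym ; occ₁ = occ₂ ; occ₂ = occ₁
      ; image = trans (fstep-swap z (a₀ , b₀ , c₀ , d₀ , w)) (cong swapExt image) }
      where open Preimage P

    module CompareParses {a b c d : ℕ} {v : List ℕ} {i i′ : ℕ}
                 (c≢d : c ≢ d) (P₁ : Parse a v c i) (P₂ : Parse b v d i′) where
      open Parse P₁ renaming (N to N₁; K to K₁; r to r₁; X to X₁; end to end₁; r< to r₁<; v≡ to v≡₁; c≡ to c≡₁)
      open Parse P₂ renaming (N to N₂; K to K₂; r to r₂; X to X₂; end to end₂; r< to r₂<; v≡ to v≡₂; c≡ to d≡₂)

      W₁ W₂ : List ℕ
      W₁ = seg (suc N₁) K₁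
      W₂ = seg (suc N₂) K₂

      c₀ d₀ : ℕ
      c₀ = U (suc N₁ + K₁)
      d₀ = U (suc N₂ + K₂)

      aligned : r₁ ≡ r₂ × X₁ ++ Φ* W₁ ≡ X₂ ++ Φ* W₂
      aligned = replicate-0-cancelʳ r₁ r₂
        (LastNonzero-++ X₁ (Φ* W₁) (LastNonzero-LeftEnd end₁) (LastNonzero-Φ* W₁))
        (LastNonzero-++ X₂ (Φ* W₂) (LastNonzero-LeftEnd end₂) (LastNonzero-Φ* W₂))
        (trans (++-assoc X₁ (Φ* W₁) _) (trans (sym v≡₁) (trans v≡₂ (sym (++-assoc X₂ (Φ* W₂) _)))))

      right : c₀ ≢ d₀ ×
              rightLetter (T (suc c₀) ⊓ T (suc d₀)) c₀ ≡ c ×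
              rightLetter (T (suc c₀) ⊓ T (suc d₀)) d₀ ≡ d ×
              fR m p t c₀ d₀ ≡ replicate r₁ 0
      right = right-extension r₁< (subst (λ r → r < length (Φ d₀)) (sym (proj₁ aligned)) r₂<) c≡₁
                (subst (λ r → d ≡ nth (Φ d₀) r) (sym (proj₁ aligned)) d≡₂) c≢d

      image : ∀ {a₀ b₀} → leftLetters z a₀ b₀ ≡ (a , b) → fL m p t a₀ b₀ ≡ X₁ →
        fstep m p t z (a₀ , b₀ , c₀ , d₀ , W₁) ≡ (a , b , c , d , v)
      image lets fL≡ = fstep-≡ z {w = W₁} lets (proj₁ (proj₂ right)) (proj₁ (proj₂ (proj₂ right)))
        (trans (cong₂ (λ l r → l ++ Φ* W₁ ++ r) fL≡ (proj₂ (proj₂ (proj₂ right)))) (sym v≡₁))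

      boundary-boundary : a ≢ b → X₁ ≡ [] → a ≡ U N₁ ⊕1 → suc (suc N₁) ≤ i →
        X₂ ≡ [] → b ≡ U N₂ ⊕1 → suc (suc N₂) ≤ i′ → Preimage a b c d v i i′
      boundary-boundary a≢b X₁≡[] a≡ N₁+2≤i X₂≡[] b≡ N₂+2≤i′ = record
        { a₀ = U N₁ ; b₀ = U N₂ ; c₀ = c₀ ; d₀ = d₀ ; j = N₁ ; j′ = N₂ ; w = W₁
        ; j+j′< = +-mono-<-≤ (≤-trans (n≤1+n (suc N₁)) N₁+2≤i)
                             (≤-trans (n≤1+n N₂) (≤-trans (n≤1+n (suc N₂)) N₂+2≤i′))
        ; a₀≢b₀ = ⊕1≢ ∘′ cong _⊕1
        ; c₀≢d₀ = proj₁ right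
        ; occ₁ = Occ-seg N₁ K₁
        ; occ₂ = subst (λ w → Occ (U N₂) w d₀ N₂) (sym W₁≡W₂) (Occ-seg N₂ K₂)
        ; image = image (trans (leftLetters-noncolliding z (⊕1≢ ∘′ CollidingPair⇒⊕1≡)) (sym (cong₂ _,_ a≡ b≡)))
                        (trans (fL-≡[] ⊕1≢) (sym X₁≡[])) }
        where
        ⊕1≢ : U N₁ ⊕1 ≢ U N₂ ⊕1
        ⊕1≢ e = a≢b (trans a≡ (trans e (sym b≡)))
        W₁≡W₂ : W₁ ≡ W₂
        W₁≡W₂ = Φ*-injective (All-seg _ _) (All-seg _ _)
                  (subst₂ (λ X Y → X ++ Φ* W₁ ≡ Y ++ Φ* W₂) X₁≡[] X₂≡[] (proj₂ aligned))

      -- 0^s (u_{N₁} ⊕ 1) is then the whole block φ(u_{N₂ + 1}), and s < t_{u_{N₁} + 1} makes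
      -- u_{N₁}, u_{N₂ + 1} the colliding pair; this forces s = tmin and b = z.
      interior-boundary : ∀ s → X₁ ≡ zerosThen s (U N₁ ⊕1) → a ≡ 0 → s < T (suc (U N₁)) → N₁ ≤ i →
        X₂ ≡ [] → b ≡ U N₂ ⊕1 → suc (suc N₂) ≤ i′ → Occ b v d i′ → Preimage a b c d v i i′
      interior-boundary s X₁≡ a≡0 s<T N₁≤i X₂≡[] b≡ N₂+2≤i′ occ =
        build (Φ*-seg-uncons (suc N₂) K₂ (⊕1≢0 (U N₁))
                (subst₂ (λ X Y → X ++ Φ* W₁ ≡ Y ++ Φ* W₂) X₁≡ X₂≡[] (proj₂ aligned)))
        where
        x a₀ w₀ : ℕ
        x  = U N₁ ⊕1
        a₀ = U N₁
        w₀ = U (suc N₂)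
        build : ∃[ K′ ] (suc K′ ≡ K₂ × s ≡ T (suc w₀) × x ≡ w₀ ⊕1 × Φ* W₁ ≡ Φ* (seg (suc (suc N₂)) K′)) →
          Preimage a b c d v i i′
        build (K′ , K≡ , s≡ , x≡ , Φ*W≡) = record
          { a₀ = a₀ ; b₀ = w₀ ; c₀ = c₀ ; d₀ = d₀ ; j = N₁ ; j′ = suc N₂ ; w = W₁
          ; j+j′< = +-mono-≤-< N₁≤i N₂+2≤i′
          ; a₀≢b₀ = a₀≢w₀
          ; c₀≢d₀ = proj₁ right
          ; occ₁ = Occ-seg N₁ K₁
          ; occ₂ = subst₂ (λ ws k → Occ w₀ ws (U k) (suc N₂)) (sym W≡)
                          (trans (sym (+-suc (suc N₂) K′)) (cong (suc N₂ +_) K≡))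
                          (Occ-seg (suc N₂) K′)
          ; image = image (trans (leftLetters-colliding z col Tw<Ta) (cong₂ _,_ (sym a≡0) (sym b≡z))) fL≡ }
          where
          Tw<Ta : T (suc w₀) < T (suc a₀)
          Tw<Ta = subst (_< T (suc a₀)) s≡ s<T
          a₀≢w₀ : a₀ ≢ w₀
          a₀≢w₀ e = <-irrefl refl (subst (λ k → T (suc w₀) < T (suc k)) e Tw<Ta)
          col : CollidingPair a₀ w₀
          col = proj₁ (⊕1-collision (U<m+p N₁) (U<m+p (suc N₂)) a₀≢w₀ x≡)
          W≡ : W₁ ≡ seg (suc (suc N₂)) K′
          W≡ = Φ*-injective (All-seg _ _) (All-seg _ _) Φ*W≡
          b≡z : b ≡ z
          b≡z = z-unique (λ b≡0 → ⊕1≢0 (U N₂) (trans (sym b≡) b≡0))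
                  (trans s≡ (T-colliding-shortfall col Tw<Ta))
                  (proj₂ (⊕1-collision (U<m+p N₁) (U<m+p (suc N₂)) a₀≢w₀ x≡))
                  (subst (λ u → Occ b u d i′) (trans v≡₁ (cong (_++ _) X₁≡)) occ)
          fL≡ : fL m p t a₀ w₀ ≡ X₁
          fL≡ = trans (fL-≡Φ x≡ (<⇒≤ Tw<Ta)) (trans (cong₂ zerosThen (sym s≡) (sym x≡)) (sym X₁≡))

    preimage : ∀ {a b c d v i i′} → a ≢ b → c ≢ d → Occ a v c i → Occ b v d i′ → ¬ ShortZeroRun v →
      Preimage a b c d v i i′
    preimage a≢b c≢d occ₁ occ₂ not-short
      with P₁ ← parse occ₁ not-short | P₂ ← parse occ₂ not-short
      with Parse.end P₁ | Parse.end P₂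
    ... | boundary X₁≡ a≡ N₁< | boundary X₂≡ b≡ N₂< =
      CompareParses.boundary-boundary c≢d P₁ P₂ a≢b X₁≡ a≡ N₁< X₂≡ b≡ N₂<
    ... | interior s X₁≡ a≡0 s< N₁≤ | boundary X₂≡ b≡ N₂< =
      CompareParses.interior-boundary c≢d P₁ P₂ s X₁≡ a≡0 s< N₁≤ X₂≡ b≡ N₂< occ₂
    ... | boundary X₁≡ a≡ N₁< | interior s X₂≡ b≡0 s< N₂≤ =
      Preimage-swap (CompareParses.interior-boundary (c≢d ∘′ sym) P₂ P₁ s X₂≡ b≡0 s< N₂≤ X₁≡ a≡ N₁< occ₁)
    ... | interior _ _ a≡0 _ _ | interior _ _ b≡0 _ _ = contradiction (trans a≡0 (sym b≡0)) a≢b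

    FImageOfShortZeroRun : ℕ → ℕ → ℕ → ℕ → List ℕ → Set
    FImageOfShortZeroRun a b c d v = ∃[ n ] ∃[ a′ ] ∃[ b′ ] ∃[ c′ ] ∃[ d′ ] ∃[ k ]
      ( (k < t 1)
      × Bispecial m p t a′ b′ c′ d′ (replicate k 0)
      × (iter (fstep m p t z) n (a′ , b′ , c′ , d′ , replicate k 0) ≡ (a , b , c , d , v)))

    FImage-fstep : ∀ {a₀ b₀ c₀ d₀ w a b c d v} → FImageOfShortZeroRun a₀ b₀ c₀ d₀ w →
      fstep m p t z (a₀ , b₀ , c₀ , d₀ , w) ≡ (a , b , c , d , v) → FImageOfShortZeroRun a b c d v
    FImage-fstep (n , a′ , b′ , c′ , d′ , k , k< , bispecial , eq) image =
      suc n , a′ , b′ , c′ , d′ , k , k< , bispecial , trans (cong (fstep m p t z) eq) image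

    ShortZeroRun? : ∀ v → Dec (ShortZeroRun v)
    ShortZeroRun? v = ≡-dec _≟_ v (replicate (length v) 0) ×-dec (length v <? t 1)

    BispecialAt : ℕ → Set
    BispecialAt n = ∀ {a b c d v i i′} → i + i′ ≡ n → a ≢ b → c ≢ d → Occ a v c i → Occ b v d i′ →
      FImageOfShortZeroRun a b c d v

    bispecialAt : ∀ n → BispecialAt n
    bispecialAt = <-rec BispecialAt step
      where
      step : ∀ n → (∀ {n′} → n′ < n → BispecialAt n′) → BispecialAt n
      step n rec {a} {b} {c} {d} {v} i+i′≡n a≢b c≢d occ-a occ-b with ShortZeroRun? v
      ... | yes (v≡ , short) =
        0 , a , b , c , d , length v , short , (a≢b , c≢d , zero-run occ-a , zero-run occ-b) ,
        cong (λ w → a , b , c , d , w) (sym v≡)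
        where
        zero-run : ∀ {x y j} → Occ x v y j → Factor m p t (x ∷ replicate (length v) 0 ++ [ y ])
        zero-run {x} {y} {j} occ = Occ⇒Factor (subst (λ w → Occ x w y j) v≡ occ)
      ... | no not-short = FImage-fstep (rec (subst (_ <_) i+i′≡n j+j′<) refl a₀≢b₀ c₀≢d₀ occ₁ occ₂) image
        where open Preimage (preimage a≢b c≢d occ-a occ-b not-short)

lemma4p7 : (m p : ℕ) {{_ : NonZero p}} (t : ℕ → ℕ)
    → IsNonSimpleParryData m p t → 2 ≤ t 1
    → (z : ℕ) → IsZ m p t z
    → (a b c d : ℕ) (v : List ℕ) → Bispecial m p t a b c d v
    → ∃[ n ] ∃[ a' ] ∃[ b' ] ∃[ c' ] ∃[ d' ] ∃[ k ]
        ( (k < t 1)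
        × Bispecial m p t a' b' c' d' (replicate k 0)
        × (iter (fstep m p t z) n (a' , b' , c' , d' , replicate k 0) ≡ (a , b , c , d , v)))
lemma4p7 m p t parry t₁≥2 z z-spec a b c d v (a≢b , c≢d , factor₁ , factor₂)
  with i , occ₁ ← ParryData.Factor⇒Occ m p t parry t₁≥2 factor₁
     | i′ , occ₂ ← ParryData.Factor⇒Occ m p t parry t₁≥2 factor₂ =
  ParryData.bispecialAt m p t parry t₁≥2 z z-spec (i + i′) refl a≢b c≢d occ₁ occ₂
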